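{- Let $x$ be a positive integer. The system $x!=x_1,\quad x_2+1=x_1,\quad x_3+1=x_2,\quad x_3!=x_4,\quad x_2\not\mid x_4$ is solvable in positive integers $x_1,x_2,x_3,x_4$ if and only if $x!-1$ is prime. In this case, the solution is unique and is given by $x_1=x!$, $x_2=x!-1$, $x_3=x!-2$, $x_4=(x!-2)!$.
   Context: $a\not\mid b$ means that $a$ does not divide $b$. -}

module Defs where

open import Data.Nat.Base using (ℕ; _!; _+_; _<_)
open import Data.Nat.Divisibility using (_∣_)
open import Data.Product using (_×_)
open import Relation.Binary.PropositionalEquality using (_≡_)
open import Relation.Nullary using (¬_)

System : ℕ → ℕ → ℕ → ℕ → ℕ → Set
System x x₁ x₂ x₃ x₄ =
  (0 < x₁) × (0 < x₂) × (0 < x₃) × (0 < x₄) ×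
  (x ! ≡ x₁) × (x₂ + 1 ≡ x₁) × (x₃ + 1 ≡ x₂) × (x₃ ! ≡ x₄) × ¬ (x₂ ∣ x₄)

module Submission where

-- The system  x! = x₁, x₂ + 1 = x₁, x₃ + 1 = x₂, x₃! = x₄, x₂ ∤ x₄  forces
-- x₁ = x!, x₂ = x! - 1, x₃ = x! - 2, x₄ = (x! - 2)!, so it is solvable exactly
-- when  x! - 1 ∤ (x! - 2)!.  The theorem therefore reduces to the
-- Wilson-type characterisation of primes through factorials:
--
--   * a prime p divides no k! with k < p (Euclid's lemma, by induction on k);
--   * a composite m = n + 1 ≠ 4 divides n!: writing m = d * e with
--     1 < d, e < m, either d ≠ e and d, e are distinct factors of n!, or
--     m = d² with d ≥ 3 and d² divides d * 2d, a product of distinct factors.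
--
-- The exceptional composite 4 never occurs, since x! - 1 = 4 would mean
-- x! = 5, while x! is 1 or even.

open import Defs
open import Data.Nat.Base using (ℕ; _!; _∸_; _<_)
open import Data.Nat.Primality using (Prime)
open import Data.Product using (_×_; ∃-syntax)
open import Function.Bundles using (_⇔_)
open import Relation.Binary.PropositionalEquality using (_≡_)

open import Data.Nat.Base using (zero; suc; _+_; _*_; _≤_; z≤n; s≤s; z<s; nonTrivial⇒n>1)
open import Data.Nat.Properties
open import Data.Nat.Divisibility
open import Data.Nat.Primality
  using (Composite; composite; ¬composite⇒prime; euclidsLemma; ¬prime[0]; ¬prime[1])
open import Data.Product using (_,_; proj₁; proj₂)
open import Data.Sum using (inj₁; inj₂)
open import Function.Bundles using (mk⇔)
open import Relation.Binary.Definitions using (tri<; tri≈; tri>)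
open import Relation.Binary.PropositionalEquality using (refl; sym; trans; cong; subst; _≢_)
open import Relation.Nullary using (¬_; Dec; yes; no; contradiction)
open import Relation.Nullary.Decidable using (from-no)

+-to-∸ : ∀ {m n o} → m + n ≡ o → m ≡ o ∸ n
+-to-∸ {m} {n} m+n≡o = trans (sym (m+n∸n≡m m n)) (cong (_∸ n) m+n≡o)

∣-factorial : ∀ {k m} → 0 < k → k ≤ m → k ∣ m !
∣-factorial {suc k} _ k≤m = ∣-trans (m∣m*n (k !)) (m≤n⇒m!∣n! k≤m)

product∣factorial : ∀ {i j} → 0 < i → i < j → i * j ∣ j !
product∣factorial {i} {suc j} 0<i (s≤s i≤j) =
  subst (i * suc j ∣_) (*-comm (j !) (suc j))
    (*-pres-∣ (∣-factorial 0<i i≤j) (∣-refl {suc j}))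

distinct-product∣factorial : ∀ {i j m} → 0 < i → 0 < j → i ≢ j →
                             i ≤ m → j ≤ m → i * j ∣ m !
distinct-product∣factorial {i} {j} {m} 0<i 0<j i≢j i≤m j≤m with <-cmp i j
... | tri< i<j _ _ = ∣-trans (product∣factorial 0<i i<j) (m≤n⇒m!∣n! j≤m)
... | tri≈ _ i≡j _ = contradiction i≡j i≢j
... | tri> _ _ j<i = subst (_∣ m !) (*-comm j i)
                       (∣-trans (product∣factorial 0<j j<i) (m≤n⇒m!∣n! i≤m))

double<square : ∀ {d} → 2 < d → d + d < d * d
double<square {d} 2<d = begin-strict
  d + d       <⟨ +-monoʳ-< d (m<m+n d 0<d) ⟩
  d + (d + d) ≡⟨ cong (λ k → d + (d + k)) (sym (+-identityʳ d)) ⟩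
  3 * d       ≤⟨ *-monoˡ-≤ d 2<d ⟩
  d * d       ∎
  where
  open ≤-Reasoning
  0<d : 0 < d
  0<d = <-trans z<s 2<d

-- A square d² ≤ m + 1 with d ≥ 3 divides m!: d² ∣ d * 2d, and d < 2d ≤ m.
square∣factorial : ∀ {d m} → 2 < d → d * d ≤ suc m → d * d ∣ m !
square∣factorial {d} {m} 2<d d²≤1+m =
  ∣-trans (*-monoʳ-∣ d (∣m∣n⇒∣m+n (∣-refl {d}) (∣-refl {d})))
    (∣-trans (product∣factorial 0<d (m<m+n d 0<d)) (m≤n⇒m!∣n! 2d≤m))
  where
  0<d : 0 < d
  0<d = <-trans z<s 2<d
  2d≤m : d + d ≤ m
  2d≤m = ≤-pred (<-≤-trans (double<square 2<d) d²≤1+m)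

square-composite∣factorial : ∀ {n d} → 1 < d → suc n ≡ d * d → suc n ≢ 4 → suc n ∣ n !
square-composite∣factorial {n} 1<d m≡d² m≢4 with m≤n⇒m<n∨m≡n 1<d
... | inj₁ 2<d = subst (_∣ n !) (sym m≡d²) (square∣factorial 2<d (≤-reflexive (sym m≡d²)))
... | inj₂ refl = contradiction m≡d² m≢4

composite∣factorial : ∀ {n} → Composite (suc n) → suc n ≢ 4 → suc n ∣ n !
composite∣factorial {n} (composite {d} d<m d∣m) m≢4 = by-cases (d ≟ e)
  where
  e : ℕ
  e = quotient d∣m
  m≡de : suc n ≡ d * e
  m≡de = m∣n⇒n≡m*quotient d∣m
  1<d : 1 < d
  1<d = nonTrivial⇒n>1 d
  by-cases : Dec (d ≡ e) → suc n ∣ n !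
  by-cases (no d≢e) = subst (_∣ n !) (sym m≡de)
    (distinct-product∣factorial (<-trans z<s 1<d) (<-trans z<s (quotient>1 d∣m d<m))
      d≢e (≤-pred d<m) (≤-pred (quotient-< d∣m)))
  by-cases (yes d≡e) = square-composite∣factorial 1<d (trans m≡de (cong (d *_) (sym d≡e))) m≢4

prime∤factorial : ∀ {p} → Prime p → ∀ {k} → k < p → ¬ p ∣ k !
prime∤factorial {p} pr {zero} _ p∣1 = ¬prime[1] (subst Prime (∣1⇒≡1 p∣1) pr)
prime∤factorial {p} pr {suc k} 1+k<p p∣k! with euclidsLemma (suc k) (k !) pr p∣k!
... | inj₁ p∣1+k = <⇒≱ 1+k<p (∣⇒≤ p∣1+k)
... | inj₂ p∣k!  = prime∤factorial pr (<-trans (n<1+n k) 1+k<p) p∣k!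

prime-if-∤-factorial : ∀ {n} → 0 < n → suc n ≢ 4 → ¬ suc n ∣ n ! → Prime (suc n)
prime-if-∤-factorial {suc n} _ m≢4 m∤n! =
  ¬composite⇒prime (λ m-composite → m∤n! (composite∣factorial m-composite m≢4))

-- x! is 1 or even, hence never 5; this rules out x! - 1 = 4.
factorial≢5 : ∀ x → x ! ≢ 5
factorial≢5 zero ()
factorial≢5 (suc zero) ()
factorial≢5 (suc (suc y)) x!≡5 =
  from-no (2 ∣? 5) (subst (2 ∣_) x!≡5 (∣-factorial {m = suc (suc y)} z<s (s≤s (s≤s z≤n))))

system-solution : ∀ {x x₁ x₂ x₃ x₄} → System x x₁ x₂ x₃ x₄ →
                  (x₁ ≡ x !) × (x₂ ≡ x ! ∸ 1) × (x₃ ≡ x ! ∸ 2) × (x₄ ≡ (x ! ∸ 2) !)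
system-solution {x} {x₃ = x₃} (_ , _ , _ , _ , refl , x₂+1≡x! , refl , refl , _) =
  refl , +-to-∸ x₂+1≡x! , x₃≡ , cong _! x₃≡
  where
  x₃≡ : x₃ ≡ x ! ∸ 2
  x₃≡ = +-to-∸ (trans (sym (+-assoc x₃ 1 1)) x₂+1≡x!)

system⇒prime : ∀ {x x₁ x₂ x₃ x₄} → System x x₁ x₂ x₃ x₄ → Prime x₂
system⇒prime {x} {x₃ = x₃} (_ , _ , 0<x₃ , _ , refl , x₂+1≡x! , refl , refl , x₂∤x₄) =
  subst Prime (sym x₂≡1+x₃)
    (prime-if-∤-factorial 0<x₃ x₂≢4 (subst (λ m → ¬ m ∣ x₃ !) x₂≡1+x₃ x₂∤x₄))
  where
  x₂≡1+x₃ : x₃ + 1 ≡ suc x₃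
  x₂≡1+x₃ = +-comm x₃ 1
  x₂≢4 : suc x₃ ≢ 4
  x₂≢4 x₂≡4 = factorial≢5 x (trans (sym x₂+1≡x!) (cong (_+ 1) (trans x₂≡1+x₃ x₂≡4)))

prime⇒system : ∀ {x n} → x ! ≡ n → Prime (n ∸ 1) → System x n (n ∸ 1) (n ∸ 2) ((n ∸ 2) !)
prime⇒system {n = zero} _ pr = contradiction pr ¬prime[0]
prime⇒system {n = suc zero} _ pr = contradiction pr ¬prime[0]
prime⇒system {n = suc (suc zero)} _ pr = contradiction pr ¬prime[1]
prime⇒system {n = suc (suc (suc k))} x!≡n pr =
  z<s , z<s , z<s , 1≤n! (suc k) ,
  x!≡n , +-comm (suc (suc k)) 1 , +-comm (suc k) 1 , refl ,
  prime∤factorial pr (n<1+n (suc k))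

lemma4 : (x : ℕ) → 0 < x →
    ((∃[ x₁ ] ∃[ x₂ ] ∃[ x₃ ] ∃[ x₄ ] System x x₁ x₂ x₃ x₄) ⇔ Prime (x ! ∸ 1))
    × (∀ x₁ x₂ x₃ x₄ → System x x₁ x₂ x₃ x₄ →
         (x₁ ≡ x !) × (x₂ ≡ x ! ∸ 1) × (x₃ ≡ x ! ∸ 2) × (x₄ ≡ (x ! ∸ 2) !))
lemma4 x _ = mk⇔ solvable⇒prime prime⇒solvable , λ _ _ _ _ → system-solution {x}
  where
  solvable⇒prime : (∃[ x₁ ] ∃[ x₂ ] ∃[ x₃ ] ∃[ x₄ ] System x x₁ x₂ x₃ x₄) → Prime (x ! ∸ 1)
  solvable⇒prime (_ , _ , _ , _ , sys) =
    subst Prime (proj₁ (proj₂ (system-solution {x} sys))) (system⇒prime {x} sys)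
  prime⇒solvable : Prime (x ! ∸ 1) → ∃[ x₁ ] ∃[ x₂ ] ∃[ x₃ ] ∃[ x₄ ] System x x₁ x₂ x₃ x₄
  prime⇒solvable pr = _ , _ , _ , _ , prime⇒system {x} refl pr
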